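{- Let $K\in\mathbb{N}$. If $n$ is a natural number with at most $K$ nonzero decimal digits, then $n$ is the sum of $2K+1$ palindromes (where the palindrome $0$ is allowed as a summand).
   Context: Every $n\in\mathbb{N}=\{0,1,2,\ldots\}$ has a unique decimal representation $n=\sum_{j=0}^{L-1}10^j\delta_j$ with digits $\delta_j\in\{0,\ldots,9\}$ and $\delta_{L-1}\ne 0$ whenever $L\ge 2$. The number $n$ is a palindrome if $\delta_j=\delta_{L-1-j}$ for all $0\le j<L$ (so $0$ and all single digits are palindromes). -}

module Defs where

open import Data.Nat using (ℕ; zero; suc; _+_; _*_; _≤_; _≟_)
open import Data.Nat.DivMod using (_/_; _%_)
open import Data.List using (List; []; _∷_; reverse; length; filter)
open import Data.Fin using (Fin)
open import Data.Vec.Functional using (Vector)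
import Data.Vec.Functional as VF
open import Relation.Binary.PropositionalEquality using (_≡_)
open import Relation.Nullary using (¬_)
open import Relation.Nullary.Decidable using (¬?)

-- Little-endian decimal digits of n with fuel; digitsAux f n is correct when f ≥ n.
-- Convention: digits 0 = [] (empty list), and for n > 0 the last digit is nonzero.
digitsAux : ℕ → ℕ → List ℕ
digitsAux zero    _       = []
digitsAux (suc f) zero    = []
digitsAux (suc f) (suc m) = (suc m % 10) ∷ digitsAux f (suc m / 10)

digits : ℕ → List ℕ
digits n = digitsAux n n

-- n is a palindrome iff its digit string reads the same reversed.
-- (0 has empty digit list, hence is a palindrome; single digits too.)
IsPalindrome : ℕ → Set
IsPalindrome n = digits n ≡ reverse (digits n)

nonzeroDigitCount : ℕ → ℕ
nonzeroDigitCount n = length (filter (λ d → ¬? (d ≟ 0)) (digits n))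

sumFin : ∀ {k} → (Fin k → ℕ) → ℕ
sumFin = VF.foldr _+_ 0

-- Write n = Σ δⱼ 10ʲ. A nonzero term d·10ʲ is a sum of two palindromes: d + 0 when j = 0,
-- (10ʲ − 1) + 1 when d = 1, and the palindrome (d−1)9…9(d−1) with j − 1 nines plus the digit 11 − d
-- when d ≥ 2. Zero digits cost nothing, and the surplus summands are filled with the palindrome 0.
module Submission where

open import Defs
open import Data.Nat using (ℕ; zero; suc; _+_; _*_; _^_; _≤_; _<_; _≟_; z≤n; s≤s; s≤s⁻¹)
open import Data.Nat.Properties
open import Data.Nat.DivMod
open import Data.Nat.Divisibility using (divides-refl)
open import Data.Nat.Solver using (module +-*-Solver)
open import Data.Fin as Fin using (Fin)
open import Data.Product using (Σ; _×_; _,_)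
open import Data.List using (List; []; _∷_; _++_; [_]; reverse; replicate; length; filter)
open import Data.List.Properties using (unfold-reverse; reverse-++; length-replicate)
open import Data.List.Relation.Unary.All.Properties using (replicate⁺)
open import Data.List.Relation.Unary.All using (All; []; _∷_)
import Data.Vec.Functional as VF
open import Relation.Binary.PropositionalEquality hiding ([_])
open import Relation.Nullary.Decidable using (¬?)

open +-*-Solver

fromDigits : List ℕ → ℕ
fromDigits []       = 0
fromDigits (a ∷ ds) = a + fromDigits ds * 10

fromDigits-++ : ∀ xs ys → fromDigits (xs ++ ys) ≡ fromDigits xs + fromDigits ys * 10 ^ length xs
fromDigits-++ []       ys = sym (*-identityʳ (fromDigits ys))
fromDigits-++ (x ∷ xs) ys = begin
    x + fromDigits (xs ++ ys) * 10
  ≡⟨ cong (λ v → x + v * 10) (fromDigits-++ xs ys) ⟩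
    x + (fromDigits xs + fromDigits ys * 10 ^ length xs) * 10
  ≡⟨ solve 4 (λ x r s t → x :+ (r :+ s :* t) :* con 10 := x :+ r :* con 10 :+ s :* (con 10 :* t))
           refl x (fromDigits xs) (fromDigits ys) (10 ^ length xs) ⟩
    x + fromDigits xs * 10 + fromDigits ys * (10 * 10 ^ length xs) ∎
  where open ≡-Reasoning

suc[m]/10≤m : ∀ m → suc m / 10 ≤ m
suc[m]/10≤m m = s≤s⁻¹ (m/n<m (suc m) 10 (s≤s (s≤s z≤n)))

digitsAux-fuel : ∀ f g n → n ≤ f → n ≤ g → digitsAux f n ≡ digitsAux g n
digitsAux-fuel zero    zero    zero    _       _       = refl
digitsAux-fuel zero    (suc g) zero    _       _       = refl
digitsAux-fuel (suc f) zero    zero    _       _       = refl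
digitsAux-fuel (suc f) (suc g) zero    _       _       = refl
digitsAux-fuel (suc f) (suc g) (suc m) (s≤s p) (s≤s q) =
  cong (suc m % 10 ∷_)
       (digitsAux-fuel f g (suc m / 10) (≤-trans (suc[m]/10≤m m) p) (≤-trans (suc[m]/10≤m m) q))

digits-suc : ∀ m → digits (suc m) ≡ suc m % 10 ∷ digits (suc m / 10)
digits-suc m = cong (suc m % 10 ∷_) (digitsAux-fuel m (suc m / 10) (suc m / 10) (suc[m]/10≤m m) ≤-refl)

digits-∷ : ∀ {a} q → a < 10 → 0 < a + q * 10 → digits (a + q * 10) ≡ a ∷ digits q
-- The positivity hypothesis is what makes the zero case of the with-abstraction absurd.
digits-∷ {a} q a<10 _ with a + q * 10 in eq
... | suc m = trans (digits-suc m) (cong₂ _∷_ lastDigit (cong digits quotient))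
  where
  lastDigit : suc m % 10 ≡ a
  lastDigit = begin
      suc m % 10         ≡⟨ cong (_% 10) (sym eq) ⟩
      (a + q * 10) % 10  ≡⟨ [m+kn]%n≡m%n a q 10 ⟩
      a % 10             ≡⟨ m<n⇒m%n≡m a<10 ⟩
      a                  ∎
    where open ≡-Reasoning
  quotient : suc m / 10 ≡ q
  quotient = begin
      suc m / 10              ≡⟨ cong (_/ 10) (sym eq) ⟩
      (a + q * 10) / 10       ≡⟨ +-distrib-/-∣ʳ a (divides-refl q) ⟩
      a / 10 + q * 10 / 10    ≡⟨ cong₂ _+_ (m<n⇒m/n≡0 a<10) (m*n/n≡m q 10) ⟩
      q                       ∎
    where open ≡-Reasoning

fromDigits-positive : ∀ ds {d} → 0 < d → 0 < fromDigits (ds ++ [ d ])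
fromDigits-positive []       {d} d>0 = ≤-trans d>0 (m≤m+n d 0)
fromDigits-positive (x ∷ ds)     d>0 =
  ≤-trans (≤-trans (fromDigits-positive ds d>0) (m≤m*n _ 10)) (m≤n+m _ x)

digits-fromDigits : ∀ {ds d} → All (_< 10) ds → 0 < d → d < 10 →
                    digits (fromDigits (ds ++ [ d ])) ≡ ds ++ [ d ]
digits-fromDigits {[]}     []            d>0 d<10 = digits-∷ 0 d<10 (fromDigits-positive [] d>0)
digits-fromDigits {x ∷ ds} (x<10 ∷ ds<10) d>0 d<10 =
  trans (digits-∷ (fromDigits (ds ++ [ _ ])) x<10 (fromDigits-positive (x ∷ ds) d>0))
        (cong (x ∷_) (digits-fromDigits ds<10 d>0 d<10))

fromDigits-isPalindrome : ∀ {ds d} → All (_< 10) ds → 0 < d → d < 10 →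
                          ds ++ [ d ] ≡ reverse (ds ++ [ d ]) → IsPalindrome (fromDigits (ds ++ [ d ]))
fromDigits-isPalindrome ds<10 d>0 d<10 palindromic
  rewrite digits-fromDigits ds<10 d>0 d<10 = palindromic

digit-isPalindrome : ∀ {d} → 0 < d → d < 10 → IsPalindrome d
digit-isPalindrome {d} d>0 d<10 =
  subst IsPalindrome (+-identityʳ d) (fromDigits-isPalindrome [] d>0 d<10 refl)

replicate-++-[] : ∀ {A : Set} n (x : A) → replicate n x ++ [ x ] ≡ x ∷ replicate n x
replicate-++-[] zero    x = refl
replicate-++-[] (suc n) x = cong (x ∷_) (replicate-++-[] n x)

reverse-replicate : ∀ {A : Set} n (x : A) → reverse (replicate n x) ≡ replicate n x
reverse-replicate zero    x = refl
reverse-replicate (suc n) x = begin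
  reverse (x ∷ replicate n x)       ≡⟨ unfold-reverse x (replicate n x) ⟩
  reverse (replicate n x) ++ [ x ]  ≡⟨ cong (_++ [ x ]) (reverse-replicate n x) ⟩
  replicate n x ++ [ x ]            ≡⟨ replicate-++-[] n x ⟩
  x ∷ replicate n x                 ∎
  where open ≡-Reasoning

fromDigits-nines : ∀ k → fromDigits (replicate k 9) + 1 ≡ 10 ^ k
fromDigits-nines zero    = refl
fromDigits-nines (suc k) = begin
    9 + fromDigits (replicate k 9) * 10 + 1
  ≡⟨ solve 1 (λ r → con 9 :+ r :* con 10 :+ con 1 := con 10 :* (r :+ con 1)) refl (fromDigits (replicate k 9)) ⟩
    10 * (fromDigits (replicate k 9) + 1)
  ≡⟨ cong (10 *_) (fromDigits-nines k) ⟩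
    10 ^ suc k ∎
  where open ≡-Reasoning

nines-palindromic : ∀ k → replicate k 9 ++ [ 9 ] ≡ reverse (replicate k 9 ++ [ 9 ])
nines-palindromic k = begin
  replicate k 9 ++ [ 9 ]             ≡⟨ replicate-++-[] k 9 ⟩
  replicate (suc k) 9                ≡⟨ sym (reverse-replicate (suc k) 9) ⟩
  reverse (replicate (suc k) 9)      ≡⟨ cong reverse (sym (replicate-++-[] k 9)) ⟩
  reverse (replicate k 9 ++ [ 9 ])   ∎
  where open ≡-Reasoning

wrap-palindromic : ∀ {A : Set} (x : A) {xs} → xs ≡ reverse xs →
                   (x ∷ xs) ++ [ x ] ≡ reverse ((x ∷ xs) ++ [ x ])
wrap-palindromic x {xs} palindromic = sym (begin
  reverse ((x ∷ xs) ++ [ x ])        ≡⟨ reverse-++ (x ∷ xs) [ x ] ⟩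
  x ∷ reverse (x ∷ xs)               ≡⟨ cong (x ∷_) (unfold-reverse x xs) ⟩
  x ∷ (reverse xs ++ [ x ])          ≡⟨ cong (λ ys → x ∷ (ys ++ [ x ])) (sym palindromic) ⟩
  (x ∷ xs) ++ [ x ]                  ∎)
  where open ≡-Reasoning

SumOfPalindromes : ℕ → ℕ → Set
SumOfPalindromes k n = Σ (Fin k → ℕ) λ p → ((i : Fin k) → IsPalindrome (p i)) × sumFin p ≡ n

infixr 5 _∷-palindrome_

_∷-palindrome_ : ∀ {x k n} → IsPalindrome x → SumOfPalindromes k n → SumOfPalindromes (suc k) (x + n)
_∷-palindrome_ {x} x-pal (p , p-pal , refl) =
  x VF.∷ p , (λ { Fin.zero → x-pal ; (Fin.suc i) → p-pal i }) , refl

zeros-sumOfPalindromes : ∀ k → SumOfPalindromes k 0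
zeros-sumOfPalindromes zero    = (λ ()) , (λ ()) , refl
zeros-sumOfPalindromes (suc k) = refl ∷-palindrome zeros-sumOfPalindromes k

sumOfPalindromes-+ : ∀ {a b v w} → SumOfPalindromes a v → SumOfPalindromes b w →
                     SumOfPalindromes (a + b) (v + w)
sumOfPalindromes-+ {zero}  (_ , _ , refl) t = t
sumOfPalindromes-+ {suc a} (p , p-pal , refl) t =
  subst (SumOfPalindromes _) (sym (+-assoc (p Fin.zero) _ _))
        (p-pal Fin.zero ∷-palindrome sumOfPalindromes-+ (VF.tail p , (λ i → p-pal (Fin.suc i)) , refl) t)

sumOfPalindromes-≤ : ∀ {k k′ n} → k ≤ k′ → SumOfPalindromes k n → SumOfPalindromes k′ n
sumOfPalindromes-≤ {k} {n = n} k≤k′ s with m≤n⇒∃[o]m+o≡n k≤k′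
... | o , refl =
  subst (SumOfPalindromes (k + o)) (+-identityʳ n) (sumOfPalindromes-+ s (zeros-sumOfPalindromes o))

twoPalindromes : ∀ {x y} → IsPalindrome x → IsPalindrome y → SumOfPalindromes 2 (x + y)
twoPalindromes {x} {y} x-pal y-pal =
  subst (SumOfPalindromes 2) (cong (x +_) (+-identityʳ y))
        (x-pal ∷-palindrome y-pal ∷-palindrome zeros-sumOfPalindromes 0)

-- Here d = c + 2 is the digit and e + 1 = 11 − d its complement.
wrapped-nines-+ : ∀ c e k → c + e ≡ 8 →
                  fromDigits ((suc c ∷ replicate k 9) ++ [ suc c ]) + suc e ≡ suc (suc c) * 10 ^ suc k
wrapped-nines-+ c e k c+e≡8 = begin
    suc c + fromDigits (replicate k 9 ++ [ suc c ]) * 10 + suc e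
  ≡⟨ cong (λ v → suc c + v * 10 + suc e) (fromDigits-++ (replicate k 9) [ suc c ]) ⟩
    suc c + (r + (suc c + 0) * 10 ^ length (replicate k 9)) * 10 + suc e
  ≡⟨ cong (λ l → suc c + (r + (suc c + 0) * 10 ^ l) * 10 + suc e) (length-replicate k) ⟩
    suc c + (r + (suc c + 0) * 10 ^ k) * 10 + suc e
  ≡⟨ cong (λ t → suc c + (r + (suc c + 0) * t) * 10 + suc e) (sym (fromDigits-nines k)) ⟩
    suc c + (r + (suc c + 0) * (r + 1)) * 10 + suc e
  ≡⟨ solve 3 (λ c e r → con 1 :+ c :+ (r :+ (con 1 :+ c :+ con 0) :* (r :+ con 1)) :* con 10 :+ (con 1 :+ e)
                       := (c :+ e) :+ con 2 :+ con 10 :* (r :+ (con 1 :+ c) :* (r :+ con 1))) refl c e r ⟩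
    (c + e) + 2 + 10 * (r + suc c * (r + 1))
  ≡⟨ cong (λ s → s + 2 + 10 * (r + suc c * (r + 1))) c+e≡8 ⟩
    10 + 10 * (r + suc c * (r + 1))
  ≡⟨ solve 2 (λ c r → con 10 :+ con 10 :* (r :+ (con 1 :+ c) :* (r :+ con 1))
                   := (con 2 :+ c) :* (con 10 :* (r :+ con 1))) refl c r ⟩
    suc (suc c) * (10 * (r + 1))
  ≡⟨ cong (λ t → suc (suc c) * (10 * t)) (fromDigits-nines k) ⟩
    suc (suc c) * 10 ^ suc k ∎
  where
  open ≡-Reasoning
  r = fromDigits (replicate k 9)

positiveDigit-sumOfPalindromes : ∀ {d} → 0 < d → d < 10 → ∀ j → SumOfPalindromes 2 (d * 10 ^ j)
positiveDigit-sumOfPalindromes {d} d>0 d<10 zero =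
  subst (SumOfPalindromes 2) (trans (+-identityʳ d) (sym (*-identityʳ d)))
        (twoPalindromes (digit-isPalindrome d>0 d<10) refl)
positiveDigit-sumOfPalindromes {1} _ _ (suc k) =
  subst (SumOfPalindromes 2) tenPower
        (twoPalindromes nines-isPalindrome (digit-isPalindrome (s≤s z≤n) (s≤s (s≤s z≤n))))
  where
  nines = replicate k 9 ++ [ 9 ]
  nines-isPalindrome : IsPalindrome (fromDigits nines)
  nines-isPalindrome =
    fromDigits-isPalindrome (replicate⁺ k (≤-refl {10})) (s≤s z≤n) ≤-refl (nines-palindromic k)
  tenPower : fromDigits nines + 1 ≡ 1 * 10 ^ suc k
  tenPower = trans (cong (λ l → fromDigits l + 1) (replicate-++-[] k 9))
                   (trans (fromDigits-nines (suc k)) (sym (*-identityˡ _)))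
positiveDigit-sumOfPalindromes {suc (suc c)} _ (s≤s (s≤s (s≤s c≤7))) (suc k)
  with m≤n⇒∃[o]m+o≡n (m≤n⇒m≤1+n c≤7)
... | e , c+e≡8 =
  subst (SumOfPalindromes 2) (wrapped-nines-+ c e k c+e≡8)
        (twoPalindromes wrapped-isPalindrome (digit-isPalindrome (s≤s z≤n) 1+e<10))
  where
  1+c<10 : suc c < 10
  1+c<10 = s≤s (s≤s (m≤n⇒m≤1+n c≤7))
  1+e<10 : suc e < 10
  1+e<10 = s≤s (s≤s (subst (e ≤_) c+e≡8 (m≤n+m e c)))
  wrapped-isPalindrome : IsPalindrome (fromDigits ((suc c ∷ replicate k 9) ++ [ suc c ]))
  wrapped-isPalindrome = fromDigits-isPalindrome (1+c<10 ∷ replicate⁺ k (≤-refl {10})) (s≤s z≤n) 1+c<10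
                                                 (wrap-palindromic (suc c) (sym (reverse-replicate k 9)))

fromDigits-digitsAux : ∀ f n → n ≤ f → fromDigits (digitsAux f n) ≡ n
fromDigits-digitsAux zero    zero    _         = refl
fromDigits-digitsAux (suc f) zero    _         = refl
fromDigits-digitsAux (suc f) (suc m) (s≤s m≤f) = begin
    suc m % 10 + fromDigits (digitsAux f (suc m / 10)) * 10
  ≡⟨ cong (λ v → suc m % 10 + v * 10) (fromDigits-digitsAux f (suc m / 10) (≤-trans (suc[m]/10≤m m) m≤f)) ⟩
    suc m % 10 + suc m / 10 * 10
  ≡⟨ sym (m≡m%n+[m/n]*n (suc m) 10) ⟩
    suc m ∎
  where open ≡-Reasoning

fromDigits-digits : ∀ n → fromDigits (digits n) ≡ n
fromDigits-digits n = fromDigits-digitsAux n n ≤-refl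

digitsAux-<10 : ∀ f n → All (_< 10) (digitsAux f n)
digitsAux-<10 zero    _       = []
digitsAux-<10 (suc f) zero    = []
digitsAux-<10 (suc f) (suc m) = m%n<n (suc m) 10 ∷ digitsAux-<10 f (suc m / 10)

nonzeroCount : List ℕ → ℕ
nonzeroCount ds = length (filter (λ d → ¬? (d ≟ 0)) ds)

shift-digit : ∀ a q j → (a + q * 10) * 10 ^ j ≡ a * 10 ^ j + q * 10 ^ suc j
shift-digit a q j =
  solve 3 (λ a q t → (a :+ q :* con 10) :* t := a :* t :+ q :* (con 10 :* t)) refl a q (10 ^ j)

digitString-sumOfPalindromes : ∀ {ds} → All (_< 10) ds → ∀ j →
                               SumOfPalindromes (2 * nonzeroCount ds) (fromDigits ds * 10 ^ j)
digitString-sumOfPalindromes []                             j = zeros-sumOfPalindromes 0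
digitString-sumOfPalindromes {zero ∷ ds}  (_ ∷ ds<10)       j =
  subst (SumOfPalindromes _) (sym (shift-digit 0 (fromDigits ds) j))
        (digitString-sumOfPalindromes ds<10 (suc j))
digitString-sumOfPalindromes {suc a ∷ ds} (1+a<10 ∷ ds<10) j =
  subst₂ SumOfPalindromes (sym (*-suc 2 (nonzeroCount ds))) (sym (shift-digit (suc a) (fromDigits ds) j))
         (sumOfPalindromes-+ (positiveDigit-sumOfPalindromes (s≤s z≤n) 1+a<10 j)
                             (digitString-sumOfPalindromes ds<10 (suc j)))

lemma2p2 : (K n : ℕ) → nonzeroDigitCount n ≤ K →
    Σ (Fin (suc (2 * K)) → ℕ) (λ p → ((i : Fin (suc (2 * K))) → IsPalindrome (p i)) × sumFin p ≡ n)
lemma2p2 K n count≤K =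
  sumOfPalindromes-≤ (m≤n⇒m≤1+n (*-monoʳ-≤ 2 count≤K))
    (subst (SumOfPalindromes _) (trans (*-identityʳ _) (fromDigits-digits n))
           (digitString-sumOfPalindromes (digitsAux-<10 n n) 0))
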